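{- Let $A$ be a c.e. set and $\mathcal{G}$ a collection of c.e. sets generating $\mathcal{D}(A)$. If $A_0\sqcup A_1=A$ is a Friedberg splitting of $A$, then $\mathcal{G}\cup\{A_1\}$ generates $\mathcal{D}(A_0)$.
   Context: All sets are c.e. subsets of $\omega$. $A_0\sqcup A_1=A$ (disjoint c.e. sets with union $A$) is a Friedberg splitting if for every c.e. $W$: if $W-A$ is not c.e., then neither $W-A_0$ nor $W-A_1$ is c.e. $X\subseteq^*Y$ means $X-Y$ is finite. A collection $\mathcal{H}$ of c.e. sets generates $\mathcal{D}(B)$ if every member of $\mathcal{H}$ is disjoint from $B$ and every c.e. set disjoint from $B$ is $\subseteq^*$ the union of finitely many members of $\mathcal{H}$. -}

module Defs where

open import Level using (0ℓ)
open import Data.Nat using (ℕ; zero; suc; _<_)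
open import Data.Fin using (Fin)
open import Data.Vec using (Vec; []; _∷_; lookup)
open import Data.Product using (Σ; ∃; _×_; _,_)
open import Data.Sum using (_⊎_)
open import Data.List using (List) renaming ([] to []ₗ; _∷_ to _∷ₗ_)
open import Data.List.Relation.Unary.All using (All)
open import Relation.Nullary using (¬_)
open import Data.Empty using (⊥)
open import Relation.Binary.PropositionalEquality using (_≡_)

data PR : ℕ → Set where
  zer  : ∀ {k} → PR k
  succ : PR 1
  proj : ∀ {k} → Fin k → PR k
  comp : ∀ {k m} → PR m → Vec (PR k) m → PR k
  prec : ∀ {k} → PR k → PR (suc (suc k)) → PR (suc k)

mutual
  eval : ∀ {k} → PR k → Vec ℕ k → ℕ
  eval zer xs = 0
  eval succ (x ∷ []) = suc x
  eval (proj i) xs = lookup xs i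
  eval (comp f gs) xs = eval f (evalVec gs xs)
  eval (prec f g) (n ∷ xs) = evalRec f g n xs

  evalVec : ∀ {k m} → Vec (PR k) m → Vec ℕ k → Vec ℕ m
  evalVec [] xs = []
  evalVec (g ∷ gs) xs = eval g xs ∷ evalVec gs xs

  evalRec : ∀ {k} → PR k → PR (suc (suc k)) → ℕ → Vec ℕ k → ℕ
  evalRec f g zero xs = eval f xs
  evalRec f g (suc n) xs = eval g (n ∷ evalRec f g n xs ∷ xs)

Set⊆ω : Set₁
Set⊆ω = ℕ → Set

-- X is c.e. (Kleene normal form): X = { n | ∃ s. R(n,s) } for some
-- primitive recursive R, here coded as "f(n,s) = 0".
CE : Set⊆ω → Set
CE X = Σ (PR 2) λ f → (n : ℕ) →
         (X n → ∃ λ s → eval f (n ∷ s ∷ []) ≡ 0)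
       × ((∃ λ s → eval f (n ∷ s ∷ []) ≡ 0) → X n)

_∖_ : Set⊆ω → Set⊆ω → Set⊆ω
(X ∖ Y) n = X n × ¬ Y n

Disjoint : Set⊆ω → Set⊆ω → Set
Disjoint X Y = (n : ℕ) → X n → Y n → ⊥

DisjointUnion : Set⊆ω → Set⊆ω → Set⊆ω → Set
DisjointUnion A₀ A₁ A = Disjoint A₀ A₁ × ((n : ℕ) → (A n → A₀ n ⊎ A₁ n) × (A₀ n ⊎ A₁ n → A n))

FriedbergSplitting : Set⊆ω → Set⊆ω → Set⊆ω → Set₁
FriedbergSplitting A₀ A₁ A =
  CE A₀ × CE A₁ × DisjointUnion A₀ A₁ A ×
  ((W : Set⊆ω) → CE W → ¬ CE (W ∖ A) → ¬ CE (W ∖ A₀) × ¬ CE (W ∖ A₁))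

Finite : Set⊆ω → Set
Finite X = ∃ λ b → (n : ℕ) → X n → n < b

_⊆*_ : Set⊆ω → Set⊆ω → Set
X ⊆* Y = Finite (X ∖ Y)

⋃ : List Set⊆ω → Set⊆ω
⋃ []ₗ n = ⊥
⋃ (X ∷ₗ Xs) n = X n ⊎ ⋃ Xs n

Collection : Set₂
Collection = Set⊆ω → Set₁

_∪｛_｝ : Collection → Set⊆ω → Collection
(𝓗 ∪｛ X ｝) Y = 𝓗 Y ⊎ (Y ≡ X)

CECollection : Collection → Set₁
CECollection 𝓗 = (X : Set⊆ω) → 𝓗 X → CE X

Generates : Collection → Set⊆ω → Set₁
Generates 𝓗 B =
  ((X : Set⊆ω) → 𝓗 X → Disjoint X B) ×
  ((V : Set⊆ω) → CE V → Disjoint V B →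
     ∃ λ (Xs : List Set⊆ω) → All 𝓗 Xs × (V ⊆* ⋃ Xs))

module Submission where

-- The members of 𝓖 are disjoint from A ⊇ A₀, and A₁ is disjoint
-- from A₀, so every member of 𝓖 ∪ {A₁} is disjoint from A₀.  For generation,
-- let V be c.e. and disjoint from A₀.  Then V − A₀ = V is c.e., and since the
-- splitting is Friedberg, V − A must be c.e. as well (contrapositive of the
-- Friedberg property; excluded middle turns "not not c.e." into "c.e.").
-- As V − A is c.e. and disjoint from A, it is almost contained in a finite
-- union ⋃ Xs of members of 𝓖.  Finally V ∩ A ⊆ A₁ (V misses A₀), so
-- V ⊆* A₁ ∪ ⋃ Xs.

open import Level using (0ℓ)
open import Axiom.ExcludedMiddle using (ExcludedMiddle)
open import Defs
open import Data.Product using (∃; _×_; _,_; proj₁; proj₂)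
open import Data.Sum using (_⊎_; inj₁; inj₂)
open import Data.List using (List) renaming (_∷_ to _∷ₗ_)
open import Data.List.Relation.Unary.All using (All; _∷_; map)
open import Data.Empty using (⊥-elim)
open import Relation.Nullary.Decidable using (decidable-stable)
open import Relation.Binary.PropositionalEquality using (refl)

-- Removing a set disjoint from V does not change V, so V − B is c.e.
-- with the same index as V.
ce-∖-disjoint : {V B : Set⊆ω} → CE V → Disjoint V B → CE (V ∖ B)
ce-∖-disjoint {V} {B} (f , V⇔f) V#B = f , λ n →
    (λ { (v , _) → proj₁ (V⇔f n) v })
  , (λ halts → let v = proj₂ (V⇔f n) halts in v , V#B n v)

-- The Friedberg property, read contrapositively: if W − A₀ is c.e. then so
-- is W − A.  Classically, since the property only yields "not not c.e.".
friedberg-reflects-ce : ExcludedMiddle 0ℓ → {A₀ A₁ A W : Set⊆ω} →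
  FriedbergSplitting A₀ A₁ A → CE W → CE (W ∖ A₀) → CE (W ∖ A)
friedberg-reflects-ce em {W = W} (_ , _ , _ , friedberg) ceW ceW∖A₀ =
  decidable-stable em (λ ¬ceW∖A → proj₁ (friedberg W ceW ¬ceW∖A) ceW∖A₀)

-- If the part of V inside Y lies in X, and the part outside Y is almost
-- contained in Z, then V is almost contained in X ∪ Z (no decidability of
-- Y is needed: an element of V outside X ∪ Z cannot lie in Y).
⊆*-split : {V Y X Z : Set⊆ω} → (∀ n → V n → Y n → X n) →
  (V ∖ Y) ⊆* Z → V ⊆* (λ n → X n ⊎ Z n)
⊆*-split V∩Y⊆X (b , bounded) =
  b , λ n → λ { (v , ∉X∪Z) →
    bounded n ((v , λ y → ∉X∪Z (inj₁ (V∩Y⊆X n v y))) , λ z → ∉X∪Z (inj₂ z)) }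

lemma3p15 : ExcludedMiddle 0ℓ →
    (A : Set⊆ω) → CE A → (𝓖 : Collection) → CECollection 𝓖 → Generates 𝓖 A →
    (A₀ A₁ : Set⊆ω) → FriedbergSplitting A₀ A₁ A →
    Generates (𝓖 ∪｛ A₁ ｝) A₀
lemma3p15 em A _ 𝓖 _ (𝓖#A , 𝓖-generates) A₀ A₁
          splitting@(_ , _ , (A₀#A₁ , A⇔A₀⊎A₁) , _) =
  members-disjoint , generates
  where
  members-disjoint : (X : Set⊆ω) → (𝓖 ∪｛ A₁ ｝) X → Disjoint X A₀
  members-disjoint X (inj₁ X∈𝓖) n x a₀ = 𝓖#A X X∈𝓖 n x (proj₂ (A⇔A₀⊎A₁ n) (inj₁ a₀))
  members-disjoint X (inj₂ refl) n a₁ a₀ = A₀#A₁ n a₀ a₁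

  generates : (V : Set⊆ω) → CE V → Disjoint V A₀ →
    ∃ λ (Xs : List Set⊆ω) → All (𝓖 ∪｛ A₁ ｝) Xs × (V ⊆* ⋃ Xs)
  generates V ceV V#A₀ =
    let ceV∖A = friedberg-reflects-ce em splitting ceV (ce-∖-disjoint ceV V#A₀)
        (Xs , Xs∈𝓖 , V∖A⊆*Xs) = 𝓖-generates (V ∖ A) ceV∖A (λ n v∖A a → proj₂ v∖A a)
    in  (A₁ ∷ₗ Xs) , (inj₂ refl ∷ map inj₁ Xs∈𝓖) , ⊆*-split V∩A⊆A₁ V∖A⊆*Xs
    where
    V∩A⊆A₁ : ∀ n → V n → A n → A₁ n
    V∩A⊆A₁ n v a with proj₁ (A⇔A₀⊎A₁ n) a
    ... | inj₁ a₀ = ⊥-elim (V#A₀ n v a₀)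
    ... | inj₂ a₁ = a₁
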